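{- If $G_1$ and $G_2$ are semi-weakly CIS graphs, then their disjoint union $G_1+G_2$ and their join $G_1*G_2$ are also semi-weakly CIS.
   Context: A strong clique is a clique meeting every maximal stable set of the graph. A graph is semi-weakly CIS if it admits an edge covering family of strong cliques, i.e., a family of strong cliques such that every two adjacent vertices are contained together in some member of the family. The disjoint union $G_1+G_2$ of vertex-disjoint graphs has vertex set $V(G_1)\cup V(G_2)$ and edge set $E(G_1)\cup E(G_2)$; the join $G_1*G_2$ additionally contains all edges $x_1x_2$ with $x_1\in V(G_1)$, $x_2\in V(G_2)$. -}

module Defs where

open import Data.Nat using (ℕ; _+_)
open import Data.Fin using (Fin; splitAt)
open import Data.Fin.Subset using (Subset; _∈_; _∉_; _⊆_)
open import Data.Bool using (Bool; true; false; T)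
open import Data.Sum using (_⊎_; inj₁; inj₂)
open import Data.Product using (Σ; _×_; ∃; ∃-syntax; _,_)
open import Data.List using (List)
open import Data.List.Membership.Propositional as L using ()
open import Data.List.Relation.Unary.All using (All)
open import Relation.Nullary using (¬_)
open import Relation.Binary.PropositionalEquality using (_≡_; refl)

record Graph : Set where
  field
    n      : ℕ
    adj    : Fin n → Fin n → Bool
    sym    : ∀ x y → adj x y ≡ adj y x
    irrefl : ∀ x → adj x x ≡ false

open Graph public

Vertex : Graph → Set
Vertex G = Fin (n G)

Adj : (G : Graph) → Vertex G → Vertex G → Set
Adj G x y = T (adj G x y)

VSet : Graph → Set
VSet G = Subset (n G)

IsClique : (G : Graph) → VSet G → Set
IsClique G C = ∀ x y → x ∈ C → y ∈ C → ¬ (x ≡ y) → Adj G x y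

IsStable : (G : Graph) → VSet G → Set
IsStable G S = ∀ x y → x ∈ S → y ∈ S → ¬ Adj G x y

IsMaximalStable : (G : Graph) → VSet G → Set
IsMaximalStable G S = IsStable G S × (∀ S′ → S ⊆ S′ → IsStable G S′ → S′ ⊆ S)

IsStrongClique : (G : Graph) → VSet G → Set
IsStrongClique G C =
  IsClique G C × (∀ S → IsMaximalStable G S → ∃[ v ] (v ∈ C × v ∈ S))

SemiWeaklyCIS : Graph → Set
SemiWeaklyCIS G =
  Σ (List (VSet G)) λ 𝓕 → (All (IsStrongClique G) 𝓕 ×
          (∀ x y → Adj G x y → ∃[ C ] (C L.∈ 𝓕 × x ∈ C × y ∈ C)))

combine : {n₁ n₂ : ℕ} → (Fin n₁ → Fin n₁ → Bool) → (Fin n₂ → Fin n₂ → Bool) → Bool →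
          Fin n₁ ⊎ Fin n₂ → Fin n₁ ⊎ Fin n₂ → Bool
combine a₁ a₂ c (inj₁ x) (inj₁ y) = a₁ x y
combine a₁ a₂ c (inj₂ x) (inj₂ y) = a₂ x y
combine a₁ a₂ c (inj₁ x) (inj₂ y) = c
combine a₁ a₂ c (inj₂ x) (inj₁ y) = c

private
  combine-sym : {n₁ n₂ : ℕ} (a₁ : Fin n₁ → Fin n₁ → Bool) (a₂ : Fin n₂ → Fin n₂ → Bool) (c : Bool) →
                (∀ x y → a₁ x y ≡ a₁ y x) → (∀ x y → a₂ x y ≡ a₂ y x) →
                ∀ u v → combine a₁ a₂ c u v ≡ combine a₁ a₂ c v u
  combine-sym a₁ a₂ c s₁ s₂ (inj₁ x) (inj₁ y) = s₁ x y
  combine-sym a₁ a₂ c s₁ s₂ (inj₂ x) (inj₂ y) = s₂ x y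
  combine-sym a₁ a₂ c s₁ s₂ (inj₁ x) (inj₂ y) = refl
  combine-sym a₁ a₂ c s₁ s₂ (inj₂ x) (inj₁ y) = refl

  combine-irr : {n₁ n₂ : ℕ} (a₁ : Fin n₁ → Fin n₁ → Bool) (a₂ : Fin n₂ → Fin n₂ → Bool) (c : Bool) →
                (∀ x → a₁ x x ≡ false) → (∀ x → a₂ x x ≡ false) →
                ∀ u → combine a₁ a₂ c u u ≡ false
  combine-irr a₁ a₂ c i₁ i₂ (inj₁ x) = i₁ x
  combine-irr a₁ a₂ c i₁ i₂ (inj₂ x) = i₂ x

-- vertices 0..n₁-1 are G₁'s, n₁..n₁+n₂-1 are G₂'s
glue : Bool → Graph → Graph → Graph
glue c G₁ G₂ = record
  { n      = n G₁ + n G₂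
  ; adj    = λ x y → combine (adj G₁) (adj G₂) c (splitAt (n G₁) x) (splitAt (n G₁) y)
  ; sym    = λ x y → combine-sym (adj G₁) (adj G₂) c (sym G₁) (sym G₂)
                       (splitAt (n G₁) x) (splitAt (n G₁) y)
  ; irrefl = λ x → combine-irr (adj G₁) (adj G₂) c (irrefl G₁) (irrefl G₂) (splitAt (n G₁) x)
  }

_⊕_ : Graph → Graph → Graph
G₁ ⊕ G₂ = glue false G₁ G₂

_⊛_ : Graph → Graph → Graph
G₁ ⊛ G₂ = glue true G₁ G₂

module Submission where

-- A graph is semi-weakly CIS iff every edge lies in some strong
-- clique: a finite family is recovered by choosing one clique per adjacent
-- pair of vertices.  So it suffices to cover the edges of G₁ + G₂ and G₁ * G₂
-- by strong cliques built from strong cliques of G₁ and G₂.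
--
-- The left
-- (right) part of a maximal stable set of G₁ + G₂ is maximal stable in G₁
-- (G₂); for G₁ * G₂ this holds when the set has no right (left) vertex.
-- Hence:
--   * in G₁ + G₂, a strong clique of one factor stays strong;
--   * in G₁ * G₂, a maximal stable set lies on one side, so A ++ B is strong
--     when A and B meet every NONEMPTY maximal stable set of their factor
--     ("quasi-strong"; needed because an empty factor has no strong clique).
-- Every vertex lies in a strong clique (an isolated vertex forms one), which
-- gives quasi-strong cliques on both sides for the cross edges of the join.

open import Defs
open import Data.Nat using (ℕ; zero; suc; _+_)
open import Data.Fin using (Fin; zero; splitAt; _↑ˡ_; _↑ʳ_)
open import Data.Fin.Properties using (splitAt-↑ˡ; splitAt-↑ʳ; splitAt⁻¹-↑ˡ; splitAt⁻¹-↑ʳ; any?)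
open import Data.Fin.Subset using (Subset; _∈_; _∉_; _⊆_; ⁅_⁆; _∪_; Nonempty) renaming (⊥ to ∅)
open import Data.Fin.Subset.Properties using (∉⊥; x∈⁅x⁆; x∈⁅y⁆⇒x≡y; _∈?_; x∈p∪q⁺; x∈p∪q⁻; nonempty?)
open import Data.Vec using (lookup; tabulate; _++_)
open import Data.Vec.Properties using (lookup∘tabulate; []=⇒lookup; lookup⇒[]=; lookup-++ˡ; lookup-++ʳ)
open import Data.Bool using (Bool; true; false; T)
open import Data.Unit using (tt)
open import Data.Empty using (⊥-elim)
open import Data.Product using (_×_; _,_; ∃-syntax)
open import Data.Sum using (_⊎_; inj₁; inj₂)
open import Data.List using (List; []; _∷_; allFin; cartesianProduct)
open import Data.List.Membership.Propositional as L using ()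
open import Data.List.Membership.Propositional.Properties using (∈-allFin; ∈-cartesianProduct⁺)
open import Data.List.Relation.Unary.All as All using (All; []; _∷_)
open import Data.List.Relation.Unary.Any using (here; there)
open import Function using (_∘_)
open import Relation.Nullary using (¬_; Dec; yes; no)
open import Relation.Nullary.Decidable using (T?)
open import Relation.Binary.PropositionalEquality using (_≡_; refl; trans; cong; subst) renaming (sym to ≡-sym)

choose-all : {A B : Set} {P : A → Set} {Q : B → Set} {R : A → B → Set} →
             (∀ a → Dec (P a)) → (∀ a → P a → ∃[ b ] (Q b × R a b)) →
             (as : List A) →
             ∃[ bs ] (All Q bs × (∀ {a} → a L.∈ as → P a → ∃[ b ] (b L.∈ bs × R a b)))
choose-all P? choose [] = [] , [] , λ ()
choose-all {R = R} P? choose (a ∷ as) with choose-all P? choose as | P? a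
... | bs , Qbs , cover | no ¬Pa = bs , Qbs , λ { (here refl) Pa → ⊥-elim (¬Pa Pa)
                                               ; (there i) → cover i }
... | bs , Qbs , cover | yes Pa with choose a Pa
...   | b , Qb , Rab = b ∷ bs , Qb ∷ Qbs , λ { (here refl) _ → b , here refl , Rab
                                              ; (there i) Pa′ → extend (cover i Pa′) }
  where
  extend : ∀ {a′} → ∃[ c ] (c L.∈ bs × R a′ c) → ∃[ c ] (c L.∈ b ∷ bs × R a′ c)
  extend (c , c∈bs , Rc) = c , there c∈bs , Rc

EdgesInStrongCliques : Graph → Set
EdgesInStrongCliques G = ∀ x y → Adj G x y → ∃[ C ] (IsStrongClique G C × x ∈ C × y ∈ C)

toEdgeCover : (G : Graph) → SemiWeaklyCIS G → EdgesInStrongCliques G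
toEdgeCover G (𝓕 , strong , cover) x y xy with cover x y xy
... | C , C∈𝓕 , x∈C , y∈C = C , All.lookup strong C∈𝓕 , x∈C , y∈C

fromEdgeCover : (G : Graph) → EdgesInStrongCliques G → SemiWeaklyCIS G
fromEdgeCover G edges with choose-all {P = λ (x , y) → Adj G x y}
                                      (λ (x , y) → T? (adj G x y))
                                      (λ (x , y) → edges x y)
                                      (cartesianProduct (allFin (n G)) (allFin (n G)))
... | 𝓕 , strong , cover =
  𝓕 , strong , λ x y → cover (∈-cartesianProduct⁺ (∈-allFin x) (∈-allFin y))

∅-clique : (G : Graph) → IsClique G ∅
∅-clique G x y x∈∅ = ⊥-elim (∉⊥ x∈∅)

singleton-clique : (G : Graph) (v : Vertex G) → IsClique G ⁅ v ⁆
singleton-clique G v x y x∈ y∈ x≢y = ⊥-elim (x≢y (trans (x∈⁅y⁆⇒x≡y v x∈) (≡-sym (x∈⁅y⁆⇒x≡y v y∈))))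

stable-∪⁅⁆ : (G : Graph) {S : VSet G} (v : Vertex G) → IsStable G S →
             (∀ y → y ∈ S → ¬ Adj G v y) → IsStable G (S ∪ ⁅ v ⁆)
stable-∪⁅⁆ G {S} v st apart x y x∈ y∈ with x∈p∪q⁻ S ⁅ v ⁆ x∈ | x∈p∪q⁻ S ⁅ v ⁆ y∈
... | inj₁ x∈S | inj₁ y∈S = st x y x∈S y∈S
... | inj₁ x∈S | inj₂ y∈v rewrite x∈⁅y⁆⇒x≡y v y∈v = apart x x∈S ∘ subst T (Graph.sym G x v)
... | inj₂ x∈v | inj₁ y∈S rewrite x∈⁅y⁆⇒x≡y v x∈v = apart y y∈S
... | inj₂ x∈v | inj₂ y∈v rewrite x∈⁅y⁆⇒x≡y v x∈v | x∈⁅y⁆⇒x≡y v y∈v = subst T (irrefl G v)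

maximal-absorbs : (G : Graph) {S : VSet G} (v : Vertex G) → IsMaximalStable G S →
                  IsStable G (S ∪ ⁅ v ⁆) → v ∈ S
maximal-absorbs G {S} v (_ , maximal) st′ =
  maximal (S ∪ ⁅ v ⁆) (x∈p∪q⁺ ∘ inj₁) st′ (x∈p∪q⁺ (inj₂ (x∈⁅x⁆ v)))

maximalStable-nonempty : (G : Graph) (u : Vertex G) {S : VSet G} →
                         IsMaximalStable G S → Nonempty S
maximalStable-nonempty G u {S} mst@(st , _) with nonempty? S
... | yes ne = ne
... | no empty = ⊥-elim (empty (u , maximal-absorbs G u mst
                   (stable-∪⁅⁆ G u st (λ y y∈S → ⊥-elim (empty (y , y∈S))))))

-- An isolated vertex lies in every maximal stable set, so it is a strong clique.
isolated-strong : (G : Graph) (v : Vertex G) → (∀ y → ¬ Adj G v y) → IsStrongClique G ⁅ v ⁆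
isolated-strong G v isolated = singleton-clique G v , meet
  where
  meet : ∀ S → IsMaximalStable G S → ∃[ w ] (w ∈ ⁅ v ⁆ × w ∈ S)
  meet S mst@(st , _) =
    v , x∈⁅x⁆ v , maximal-absorbs G v mst (stable-∪⁅⁆ G v st (λ y _ → isolated y))

-- Every vertex lies in a strong clique: through one of its edges, or alone.
vertex-in-strong-clique : (G : Graph) → EdgesInStrongCliques G →
                          ∀ v → ∃[ C ] (IsStrongClique G C × v ∈ C)
vertex-in-strong-clique G edges v with any? (λ u → T? (adj G v u))
... | yes (u , vu) with edges v u vu
...   | C , strong , v∈C , _ = C , strong , v∈C
vertex-in-strong-clique G edges v | no isolated =
  ⁅ v ⁆ , isolated-strong G v (λ y vy → isolated (y , vy)) , x∈⁅x⁆ v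

-- A clique meeting every nonempty maximal stable set.  In a graph with at
-- least one vertex this is the same as a strong clique.
IsQuasiStrong : (G : Graph) → VSet G → Set
IsQuasiStrong G C =
  IsClique G C × (∀ S → IsMaximalStable G S → Nonempty S → ∃[ v ] (v ∈ C × v ∈ S))

strong⇒quasi : (G : Graph) {C : VSet G} → IsStrongClique G C → IsQuasiStrong G C
strong⇒quasi G (clique , meet) = clique , λ S mst _ → meet S mst

quasi⇒strong : (G : Graph) {C : VSet G} → Vertex G → IsQuasiStrong G C → IsStrongClique G C
quasi⇒strong G u (clique , meet) =
  clique , λ S mst → meet S mst (maximalStable-nonempty G u mst)

vertex? : (G : Graph) → Dec (Fin (n G))
vertex? G with n G
... | zero  = no λ ()
... | suc _ = yes zero

quasi-exists : (G : Graph) → EdgesInStrongCliques G → ∃[ C ] (IsQuasiStrong G C)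
quasi-exists G edges with vertex? G
... | yes v with vertex-in-strong-clique G edges v
...   | C , strong , _ = C , strong⇒quasi G strong
quasi-exists G edges | no none = ∅ , ∅-clique G , λ { S _ (v , _) → ⊥-elim (none v) }

module Parts (m k : ℕ) where

  data Side : Fin (m + k) → Set where
    left  : (a : Fin m) → Side (a ↑ˡ k)
    right : (b : Fin k) → Side (m ↑ʳ b)

  side : ∀ x → Side x
  side x with splitAt m x in eq
  ... | inj₁ a = subst Side (splitAt⁻¹-↑ˡ eq) (left a)
  ... | inj₂ b = subst Side (splitAt⁻¹-↑ʳ eq) (right b)

  ∈-transport : ∀ {i j} {p : Subset i} {q : Subset j} {x y} →
                lookup p x ≡ lookup q y → x ∈ p → y ∈ q
  ∈-transport {q = q} {y = y} eq x∈p = lookup⇒[]= y q (trans (≡-sym eq) ([]=⇒lookup x∈p))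

  restrictˡ : Subset (m + k) → Subset m
  restrictˡ S = tabulate (λ a → lookup S (a ↑ˡ k))

  restrictʳ : Subset (m + k) → Subset k
  restrictʳ S = tabulate (λ b → lookup S (m ↑ʳ b))

  module _ {A : Subset m} {B : Subset k} where
    ∈-++ˡ⁺ : ∀ {a} → a ∈ A → a ↑ˡ k ∈ A ++ B
    ∈-++ˡ⁺ {a} = ∈-transport (≡-sym (lookup-++ˡ A B a))

    ∈-++ˡ⁻ : ∀ {a} → a ↑ˡ k ∈ A ++ B → a ∈ A
    ∈-++ˡ⁻ {a} = ∈-transport (lookup-++ˡ A B a)

    ∈-++ʳ⁺ : ∀ {b} → b ∈ B → m ↑ʳ b ∈ A ++ B
    ∈-++ʳ⁺ {b} = ∈-transport (≡-sym (lookup-++ʳ A B b))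

    ∈-++ʳ⁻ : ∀ {b} → m ↑ʳ b ∈ A ++ B → b ∈ B
    ∈-++ʳ⁻ {b} = ∈-transport (lookup-++ʳ A B b)

  module _ {S : Subset (m + k)} where
    ∈-restrictˡ⁺ : ∀ {a} → a ↑ˡ k ∈ S → a ∈ restrictˡ S
    ∈-restrictˡ⁺ {a} = ∈-transport (≡-sym (lookup∘tabulate _ a))

    ∈-restrictˡ⁻ : ∀ {a} → a ∈ restrictˡ S → a ↑ˡ k ∈ S
    ∈-restrictˡ⁻ {a} = ∈-transport (lookup∘tabulate _ a)

    ∈-restrictʳ⁺ : ∀ {b} → m ↑ʳ b ∈ S → b ∈ restrictʳ S
    ∈-restrictʳ⁺ {b} = ∈-transport (≡-sym (lookup∘tabulate _ b))

    ∈-restrictʳ⁻ : ∀ {b} → b ∈ restrictʳ S → m ↑ʳ b ∈ S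
    ∈-restrictʳ⁻ {b} = ∈-transport (lookup∘tabulate _ b)

  ⊆-++ : ∀ {S A B} → restrictˡ S ⊆ A → restrictʳ S ⊆ B → S ⊆ A ++ B
  ⊆-++ {S} {A} {B} subˡ subʳ {x} = go (side x)
    where
    go : ∀ {x} → Side x → x ∈ S → x ∈ A ++ B
    go (left a)  a∈S = ∈-++ˡ⁺ (subˡ (∈-restrictˡ⁺ a∈S))
    go (right b) b∈S = ∈-++ʳ⁺ (subʳ (∈-restrictʳ⁺ b∈S))

module Glue (G₁ G₂ : Graph) (c : Bool) where

  open Parts (n G₁) (n G₂) public

  private
    m k : ℕ
    m = n G₁
    k = n G₂

  H : Graph
  H = glue c G₁ G₂

  adj-ll : ∀ a a′ → adj H (a ↑ˡ k) (a′ ↑ˡ k) ≡ adj G₁ a a′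
  adj-ll a a′ rewrite splitAt-↑ˡ m a k | splitAt-↑ˡ m a′ k = refl

  adj-rr : ∀ b b′ → adj H (m ↑ʳ b) (m ↑ʳ b′) ≡ adj G₂ b b′
  adj-rr b b′ rewrite splitAt-↑ʳ m k b | splitAt-↑ʳ m k b′ = refl

  adj-lr : ∀ a b → adj H (a ↑ˡ k) (m ↑ʳ b) ≡ c
  adj-lr a b rewrite splitAt-↑ˡ m a k | splitAt-↑ʳ m k b = refl

  adj-rl : ∀ b a → adj H (m ↑ʳ b) (a ↑ˡ k) ≡ c
  adj-rl b a rewrite splitAt-↑ˡ m a k | splitAt-↑ʳ m k b = refl

  ++-clique : ∀ {A B} → IsClique G₁ A → IsClique G₂ B →
              (∀ {a b} → a ∈ A → b ∈ B → T c) → IsClique H (A ++ B)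
  ++-clique {A} {B} clique₁ clique₂ cross x y = go (side x) (side y)
    where
    go : ∀ {x y} → Side x → Side y → x ∈ A ++ B → y ∈ A ++ B → ¬ x ≡ y → Adj H x y
    go (left a) (left a′) p q a≢a′ = subst T (≡-sym (adj-ll a a′))
      (clique₁ a a′ (∈-++ˡ⁻ p) (∈-++ˡ⁻ q) (a≢a′ ∘ cong (_↑ˡ k)))
    go (right b) (right b′) p q b≢b′ = subst T (≡-sym (adj-rr b b′))
      (clique₂ b b′ (∈-++ʳ⁻ p) (∈-++ʳ⁻ q) (b≢b′ ∘ cong (m ↑ʳ_)))
    go (left a) (right b) p q _ = subst T (≡-sym (adj-lr a b)) (cross (∈-++ˡ⁻ p) (∈-++ʳ⁻ q))
    go (right b) (left a) p q _ = subst T (≡-sym (adj-rl b a)) (cross (∈-++ˡ⁻ q) (∈-++ʳ⁻ p))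

  ++-stable : ∀ {A B} → IsStable G₁ A → IsStable G₂ B →
              (∀ {a b} → a ∈ A → b ∈ B → ¬ T c) → IsStable H (A ++ B)
  ++-stable {A} {B} stable₁ stable₂ cross x y = go (side x) (side y)
    where
    go : ∀ {x y} → Side x → Side y → x ∈ A ++ B → y ∈ A ++ B → ¬ Adj H x y
    go (left a) (left a′) p q = stable₁ a a′ (∈-++ˡ⁻ p) (∈-++ˡ⁻ q) ∘ subst T (adj-ll a a′)
    go (right b) (right b′) p q = stable₂ b b′ (∈-++ʳ⁻ p) (∈-++ʳ⁻ q) ∘ subst T (adj-rr b b′)
    go (left a) (right b) p q = cross (∈-++ˡ⁻ p) (∈-++ʳ⁻ q) ∘ subst T (adj-lr a b)
    go (right b) (left a) p q = cross (∈-++ˡ⁻ q) (∈-++ʳ⁻ p) ∘ subst T (adj-rl b a)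

  restrictˡ-stable : ∀ {S} → IsStable H S → IsStable G₁ (restrictˡ S)
  restrictˡ-stable stable a a′ p q = stable _ _ (∈-restrictˡ⁻ p) (∈-restrictˡ⁻ q) ∘ subst T (≡-sym (adj-ll a a′))

  restrictʳ-stable : ∀ {S} → IsStable H S → IsStable G₂ (restrictʳ S)
  restrictʳ-stable stable b b′ p q = stable _ _ (∈-restrictʳ⁻ p) (∈-restrictʳ⁻ q) ∘ subst T (≡-sym (adj-rr b b′))

  -- The left part of a maximal stable set is maximal stable in G₁, provided
  -- (in the join) the set has no right vertex: a larger stable set of G₁,
  -- glued with the right part, would be a larger stable set of H.
  restrictˡ-maximal : ∀ {S} → IsMaximalStable H S → (T c → ∀ b → m ↑ʳ b ∉ S) →
                      IsMaximalStable G₁ (restrictˡ S)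
  restrictˡ-maximal {S} (stable , maximal) noRight = restrictˡ-stable stable , grow
    where
    grow : ∀ S₁ → restrictˡ S ⊆ S₁ → IsStable G₁ S₁ → S₁ ⊆ restrictˡ S
    grow S₁ sub stable₁ a∈S₁ = ∈-restrictˡ⁺ (maximal (S₁ ++ restrictʳ S) (⊆-++ sub (λ b → b))
      (++-stable stable₁ (restrictʳ-stable stable) (λ _ b∈ t → noRight t _ (∈-restrictʳ⁻ b∈)))
      (∈-++ˡ⁺ a∈S₁))

  restrictʳ-maximal : ∀ {S} → IsMaximalStable H S → (T c → ∀ a → a ↑ˡ k ∉ S) →
                      IsMaximalStable G₂ (restrictʳ S)
  restrictʳ-maximal {S} (stable , maximal) noLeft = restrictʳ-stable stable , grow
    where
    grow : ∀ S₂ → restrictʳ S ⊆ S₂ → IsStable G₂ S₂ → S₂ ⊆ restrictʳ S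
    grow S₂ sub stable₂ b∈S₂ = ∈-restrictʳ⁺ (maximal (restrictˡ S ++ S₂) (⊆-++ (λ a → a) sub)
      (++-stable (restrictˡ-stable stable) stable₂ (λ a∈ _ t → noLeft t _ (∈-restrictˡ⁻ a∈)))
      (∈-++ʳ⁺ b∈S₂))

module Union (G₁ G₂ : Graph) where

  open Glue G₁ G₂ false

  strongˡ : ∀ {A} → IsStrongClique G₁ A → IsStrongClique (G₁ ⊕ G₂) (A ++ ∅)
  strongˡ {A} (clique , meet) = ++-clique clique (∅-clique G₂) (λ _ b∈∅ → ⊥-elim (∉⊥ b∈∅)) , meet′
    where
    meet′ : ∀ S → IsMaximalStable (G₁ ⊕ G₂) S → ∃[ v ] (v ∈ A ++ ∅ × v ∈ S)
    meet′ S mst with meet (restrictˡ S) (restrictˡ-maximal mst (λ ()))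
    ... | a , a∈A , a∈S = a ↑ˡ n G₂ , ∈-++ˡ⁺ a∈A , ∈-restrictˡ⁻ a∈S

  strongʳ : ∀ {B} → IsStrongClique G₂ B → IsStrongClique (G₁ ⊕ G₂) (∅ ++ B)
  strongʳ {B} (clique , meet) = ++-clique (∅-clique G₁) clique (λ a∈∅ _ → ⊥-elim (∉⊥ a∈∅)) , meet′
    where
    meet′ : ∀ S → IsMaximalStable (G₁ ⊕ G₂) S → ∃[ v ] (v ∈ ∅ ++ B × v ∈ S)
    meet′ S mst with meet (restrictʳ S) (restrictʳ-maximal mst (λ ()))
    ... | b , b∈B , b∈S = n G₁ ↑ʳ b , ∈-++ʳ⁺ b∈B , ∈-restrictʳ⁻ b∈S

  union-edges : EdgesInStrongCliques G₁ → EdgesInStrongCliques G₂ → EdgesInStrongCliques (G₁ ⊕ G₂)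
  union-edges edges₁ edges₂ x y = go (side x) (side y)
    where
    go : ∀ {x y} → Side x → Side y → Adj (G₁ ⊕ G₂) x y →
         ∃[ C ] (IsStrongClique (G₁ ⊕ G₂) C × x ∈ C × y ∈ C)
    go (left a) (left a′) aa′ with edges₁ a a′ (subst T (adj-ll a a′) aa′)
    ... | A , strong , a∈A , a′∈A = A ++ ∅ , strongˡ strong , ∈-++ˡ⁺ a∈A , ∈-++ˡ⁺ a′∈A
    go (right b) (right b′) bb′ with edges₂ b b′ (subst T (adj-rr b b′) bb′)
    ... | B , strong , b∈B , b′∈B = ∅ ++ B , strongʳ strong , ∈-++ʳ⁺ b∈B , ∈-++ʳ⁺ b′∈B
    go (left a) (right b) ab = ⊥-elim (subst T (adj-lr a b) ab)
    go (right b) (left a) ba = ⊥-elim (subst T (adj-rl b a) ba)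

module Join (G₁ G₂ : Graph) where

  open Glue G₁ G₂ true

  one-sided : ∀ {S} → IsMaximalStable (G₁ ⊛ G₂) S → Nonempty S →
              (IsMaximalStable G₁ (restrictˡ S) × Nonempty (restrictˡ S)) ⊎
              (IsMaximalStable G₂ (restrictʳ S) × Nonempty (restrictʳ S))
  one-sided {S} mst@(stable , _) (v , v∈S) with any? (λ b → n G₁ ↑ʳ b ∈? S)
  ... | yes (b , b∈S) = inj₂ (restrictʳ-maximal mst noLeft , b , ∈-restrictʳ⁺ b∈S)
    where
    noLeft : T true → ∀ a → a ↑ˡ n G₂ ∉ S
    noLeft _ a a∈S = stable _ _ a∈S b∈S (subst T (≡-sym (adj-lr a b)) tt)
  ... | no noRight = inj₁ (restrictˡ-maximal mst (λ _ b b∈S → noRight (b , b∈S)) , leftVertex (side v) v∈S)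
    where
    leftVertex : ∀ {v} → Side v → v ∈ S → Nonempty (restrictˡ S)
    leftVertex (left a) a∈S = a , ∈-restrictˡ⁺ a∈S
    leftVertex (right b) b∈S = ⊥-elim (noRight (b , b∈S))

  -- glued quasi-strong cliques: the join's maximal stable sets are one-sided
  ++-quasiStrong : ∀ {A B} → IsQuasiStrong G₁ A → IsQuasiStrong G₂ B →
                   IsQuasiStrong (G₁ ⊛ G₂) (A ++ B)
  ++-quasiStrong {A} {B} (clique₁ , meet₁) (clique₂ , meet₂) =
    ++-clique clique₁ clique₂ (λ _ _ → tt) , meet
    where
    meet : ∀ S → IsMaximalStable (G₁ ⊛ G₂) S → Nonempty S → ∃[ v ] (v ∈ A ++ B × v ∈ S)
    meet S mst ne with one-sided mst ne
    ... | inj₁ (mst₁ , ne₁) with meet₁ (restrictˡ S) mst₁ ne₁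
    ...   | a , a∈A , a∈S = a ↑ˡ n G₂ , ∈-++ˡ⁺ a∈A , ∈-restrictˡ⁻ a∈S
    meet S mst ne | inj₂ (mst₂ , ne₂) with meet₂ (restrictʳ S) mst₂ ne₂
    ...   | b , b∈B , b∈S = n G₁ ↑ʳ b , ∈-++ʳ⁺ b∈B , ∈-restrictʳ⁻ b∈S

  glued-strong : ∀ {A B x y} → IsQuasiStrong G₁ A → IsQuasiStrong G₂ B →
                 x ∈ A ++ B → y ∈ A ++ B → ∃[ C ] (IsStrongClique (G₁ ⊛ G₂) C × x ∈ C × y ∈ C)
  glued-strong {x = x} quasi₁ quasi₂ x∈ y∈ =
    _ , quasi⇒strong (G₁ ⊛ G₂) x (++-quasiStrong quasi₁ quasi₂) , x∈ , y∈

  join-edges : EdgesInStrongCliques G₁ → EdgesInStrongCliques G₂ → EdgesInStrongCliques (G₁ ⊛ G₂)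
  join-edges edges₁ edges₂ x y = go (side x) (side y)
    where
    through : (G : Graph) → EdgesInStrongCliques G → ∀ v → ∃[ C ] (IsQuasiStrong G C × v ∈ C)
    through G edges v with vertex-in-strong-clique G edges v
    ... | C , strong , v∈C = C , strong⇒quasi G strong , v∈C

    -- an edge inside a factor is covered by its clique glued with any
    -- quasi-strong clique of the other factor; a cross edge by cliques
    -- through each endpoint
    go : ∀ {x y} → Side x → Side y → Adj (G₁ ⊛ G₂) x y →
         ∃[ C ] (IsStrongClique (G₁ ⊛ G₂) C × x ∈ C × y ∈ C)
    go (left a) (left a′) aa′ with edges₁ a a′ (subst T (adj-ll a a′) aa′) | quasi-exists G₂ edges₂
    ... | A , strong , a∈A , a′∈A | B , quasi =
      glued-strong (strong⇒quasi G₁ strong) quasi (∈-++ˡ⁺ a∈A) (∈-++ˡ⁺ a′∈A)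
    go (right b) (right b′) bb′ with edges₂ b b′ (subst T (adj-rr b b′) bb′) | quasi-exists G₁ edges₁
    ... | B , strong , b∈B , b′∈B | A , quasi =
      glued-strong quasi (strong⇒quasi G₂ strong) (∈-++ʳ⁺ b∈B) (∈-++ʳ⁺ b′∈B)
    go (left a) (right b) _ with through G₁ edges₁ a | through G₂ edges₂ b
    ... | A , quasi₁ , a∈A | B , quasi₂ , b∈B = glued-strong quasi₁ quasi₂ (∈-++ˡ⁺ a∈A) (∈-++ʳ⁺ b∈B)
    go (right b) (left a) _ with through G₁ edges₁ a | through G₂ edges₂ b
    ... | A , quasi₁ , a∈A | B , quasi₂ , b∈B = glued-strong quasi₁ quasi₂ (∈-++ʳ⁺ b∈B) (∈-++ˡ⁺ a∈A)

proposition15 : (G₁ G₂ : Graph) → SemiWeaklyCIS G₁ → SemiWeaklyCIS G₂ →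
                SemiWeaklyCIS (G₁ ⊕ G₂) × SemiWeaklyCIS (G₁ ⊛ G₂)
proposition15 G₁ G₂ sw₁ sw₂ =
  fromEdgeCover (G₁ ⊕ G₂) (Union.union-edges G₁ G₂ edges₁ edges₂) ,
  fromEdgeCover (G₁ ⊛ G₂) (Join.join-edges G₁ G₂ edges₁ edges₂)
  where
  edges₁ : EdgesInStrongCliques G₁
  edges₁ = toEdgeCover G₁ sw₁
  edges₂ : EdgesInStrongCliques G₂
  edges₂ = toEdgeCover G₂ sw₂
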